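{- Let $w,h\geqslant 1$ be integers and let $k$ be an integer with $1\leqslant k\leqslant hw+1$ and $k\equiv wh+1\pmod 2$. Then \[ a_{w[h]}^{[k]}=\begin{cases} a_{(w-1)[h]}^{[k-h]} & \text{if } wh+1-2w<k\leqslant wh+1,\\ a_{(w-1)[h]}^{[k-h]}+a_{w[h-1]}^{[k+w]} & \text{if } h<k\leqslant hw+1-2w,\\ a_{w[h-1]}^{[k+w]}-a_{(w-1)[h]}^{[h-k]} & \text{if } 1\leqslant k\leqslant h, \end{cases} \] and \[ a_{w[h]}^{[k]}=\begin{cases} a_{w[h-1]}^{[k-w]} & \text{if } wh+1-2h<k\leqslant wh+1,\\ a_{w[h-1]}^{[k-w]}+a_{(w-1)[h]}^{[k+h]} & \text{if } w<k\leqslant hw+1-2h,\\ a_{(w-1)[h]}^{[k+h]}-a_{w[h-1]}^{[w-k]} & \text{if } 1\leqslant k\leqslant w. \end{cases} \]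
   Context: For $n\geqslant 0$ let $[n]_q=\frac{q^n-q^{ -n}}{q-q^{ -1}}$, and for integers $0\le j\le n$ let $\left[\begin{smallmatrix}n\\ j\end{smallmatrix}\right]_q=\frac{[n]_q[n-1]_q\cdots[n-j+1]_q}{[j]_q[j-1]_q\cdots[1]_q}$. For integers $w,h\geqslant 0$, the Laurent polynomial $\left[\begin{smallmatrix}w+h\\ w\end{smallmatrix}\right]_q$ (which equals $s_{(w)}(q^{ -h},q^{ -h+2},\ldots,q^h)$) is invariant under $q\mapsto q^{ -1}$ and can be written uniquely as $\sum_{k\geqslant 1}a_{w[h]}^{[k]}[k]_q$ with integers $a_{w[h]}^{[k]}$; by convention $a_{w[h]}^{[0]}=0$. -}

module Defs where

open import Data.Nat as ℕ using (ℕ; zero; suc)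
open import Data.Integer as ℤ using (ℤ; +_; -[1+_]; _⊓_; ∣_∣)
open import Data.List using (List; []; _∷_; map; replicate; _++_)
open import Data.Product using (Σ; _×_; _,_)
open import Relation.Binary.PropositionalEquality using (_≡_)

-- Laurent polynomials in q with integer coefficients, represented as
-- (lowest exponent o , coefficient list cs): the polynomial
-- Σ_i cs[i] q^(o+i).
LPoly : Set
LPoly = ℤ × List ℤ

addL : List ℤ → List ℤ → List ℤ
addL [] ys = ys
addL (x ∷ xs) [] = x ∷ xs
addL (x ∷ xs) (y ∷ ys) = (x ℤ.+ y) ∷ addL xs ys

mulL : List ℤ → List ℤ → List ℤ
mulL [] ys = []
mulL (x ∷ xs) ys = addL (map (x ℤ.*_) ys) (+ 0 ∷ mulL xs ys)

-- rewrite a Laurent polynomial with a (lower or equal) offset o'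
padTo : ℤ → LPoly → List ℤ
padTo o' (o , cs) = replicate ∣ o ℤ.- o' ∣ (+ 0) ++ cs

_⊕_ : LPoly → LPoly → LPoly
(o₁ , c₁) ⊕ (o₂ , c₂) =
  let o = o₁ ⊓ o₂ in (o , addL (padTo o (o₁ , c₁)) (padTo o (o₂ , c₂)))

_⊗_ : LPoly → LPoly → LPoly
(o₁ , c₁) ⊗ (o₂ , c₂) = (o₁ ℤ.+ o₂ , mulL c₁ c₂)

_·_ : ℤ → LPoly → LPoly
c · (o , cs) = (o , map (c ℤ.*_) cs)

zeroP : LPoly
zeroP = (+ 0 , [])

oneP : LPoly
oneP = (+ 0 , + 1 ∷ [])

idx : List ℤ → ℕ → ℤ
idx [] _ = + 0
idx (x ∷ xs) zero = x
idx (x ∷ xs) (suc n) = idx xs n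

coeff : LPoly → ℤ → ℤ
coeff (o , cs) n with n ℤ.- o
... | + m = idx cs m
... | -[1+ _ ] = + 0

_≈_ : LPoly → LPoly → Set
p ≈ r = ∀ n → coeff p n ≡ coeff r n

alt : ℕ → List ℤ
alt zero = + 1 ∷ []
alt (suc m) = + 1 ∷ + 0 ∷ alt m

-- the quantum integer [n]_q = (q^n - q^-n)/(q - q^-1)
--   = q^(n-1) + q^(n-3) + ... + q^(-(n-1)),   [0]_q = 0
qint : ℕ → LPoly
qint zero = zeroP
qint (suc m) = (ℤ.- (+ m) , alt m)

qfact : ℕ → LPoly
qfact zero = oneP
qfact (suc j) = qint (suc j) ⊗ qfact j

qfalling : ℕ → ℕ → LPoly
qfalling n zero = oneP
qfalling n (suc j) = qint (n ℕ.∸ j) ⊗ qfalling n j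

sumQ : ℕ → (ℕ → ℤ) → LPoly
sumQ zero a = zeroP
sumQ (suc N) a = sumQ N a ⊕ (a (suc N) · qint (suc N))

-- The Laurent polynomial P equals the q-binomial [n over j]_q, i.e.
-- P = ([n]_q ... [n-j+1]_q) / ([j]_q ... [1]_q), stated by clearing
-- the denominator in the (integral domain) ring of Laurent polynomials.
IsQBinom : ℕ → ℕ → LPoly → Set
IsQBinom n j P = (qfact j ⊗ P) ≈ qfalling n j

-- a (as a function k ↦ a^{[k]}_{w[h]}) is the coefficient sequence of
-- the decomposition [w+h over w]_q = Σ_{k≥1} a_k [k]_q (finitely many
-- nonzero terms), with the convention a_0 = 0.
IsCoeffSeq : ℕ → ℕ → (ℕ → ℤ) → Set
IsCoeffSeq w h a =
  (a 0 ≡ + 0) ×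
  Σ ℕ (λ N → (∀ k → N ℕ.< k → a k ≡ + 0) × IsQBinom (w ℕ.+ h) w (sumQ N a))

{-# OPTIONS --safe #-}
module Submission where

-- Write c_{w,h}(n) for the coefficient of qⁿ in [w+h over w]_q. Since
-- (q − q⁻¹)[k]_q = q^k − q^(−k), the coefficient a^{[k]}_{w[h]} is
-- ∂c(k) = c(k−1) − c(k+1), and ∂c is odd because c is symmetric. The q-Pascal rule
-- [w+h over w] = q^w [w+h−1 over w] + q^(−h) [w+h−1 over w−1] gives
-- ∂c_{w,h}(k) = ∂c_{w,h−1}(k−w) + ∂c_{w−1,h}(k+h). The first summand is
-- a^{[k−w]}_{w[h−1]} or −a^{[w−k]}_{w[h−1]} according to the sign of k − w, and the
-- second, a^{[k+h]}_{(w−1)[h]}, vanishes once k + h exceeds (w−1)h + 1: this is the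
-- second system. The first system is the second one for the transposed rectangle, as
-- [w+h over w] = [w+h over h].
-- Since the q-binomial is only characterised by [w]_q! · P = [w+h]_q ⋯ [h+1]_q,
-- everything rests on cancelling quantum integers on Laurent series bounded below:
-- [m+1]_q · E = 0 forces E to be 2(m+1)-periodic, hence zero.

open import Defs

module QBinomialCoefficients where
  open import Data.Empty using (⊥-elim)
  open import Data.Integer
    using (ℤ; +_; -[1+_]; 0ℤ; 1ℤ; _+_; _-_; _*_; -_; _⊖_; ∣_∣; _⊓_; _<_; _≤_; +<+; -<+)
  open import Data.Integer.Properties
  open import Data.Integer.Tactic.RingSolver using (solve-∀)
  open import Data.List using (List; []; _∷_; map; replicate; _++_)
  open import Data.Nat as ℕ using (ℕ; zero; suc)
  import Data.Nat.Properties as ℕₚ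
  import Data.Nat.Tactic.RingSolver as ℕ-Solver
  open import Data.Product using (∃; _×_; _,_; proj₁; proj₂)
  open import Function using (_∘_; const)
  open import Relation.Binary.Definitions using (tri<; tri≈; tri>)
  open import Relation.Binary.PropositionalEquality
  open import Relation.Nullary using (yes; no)
  open ≡-Reasoning

  -- Laurent series as coefficient functions

  Coeffs : Set
  Coeffs = ℤ → ℤ

  VanishesBelow : Coeffs → ℤ → Set
  VanishesBelow f L = ∀ z → z < L → f z ≡ 0ℤ

  BoundedBelow : Coeffs → Set
  BoundedBelow f = ∃ (VanishesBelow f)

  vanishesBelow-≤ : ∀ {f L M} → M ≤ L → VanishesBelow f L → VanishesBelow f M
  vanishesBelow-≤ M≤L f↓ z z<M = f↓ z (<-≤-trans z<M M≤L)

  vanishesBelow-shift : ∀ {f L} s → VanishesBelow f L → VanishesBelow (λ z → f (z + s)) (L - s)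
  vanishesBelow-shift {f} {L} s f↓ z z<L-s =
    f↓ (z + s) (subst (z + s <_) (L-s+s≡L L s) (+-monoˡ-< s z<L-s))
    where
    L-s+s≡L : ∀ L s → L - s + s ≡ L
    L-s+s≡L = solve-∀

  boundedBelow-shift : ∀ {f} s → BoundedBelow f → BoundedBelow (λ z → f (z + s))
  boundedBelow-shift s (L , f↓) = L - s , vanishesBelow-shift s f↓

  vanishesBelow-zipWith : (_∙_ : ℤ → ℤ → ℤ) → 0ℤ ∙ 0ℤ ≡ 0ℤ → ∀ {f g L} →
    VanishesBelow f L → VanishesBelow g L → VanishesBelow (λ z → f z ∙ g z) L
  vanishesBelow-zipWith _∙_ 0∙0≡0 f↓ g↓ z z<L = trans (cong₂ _∙_ (f↓ z z<L) (g↓ z z<L)) 0∙0≡0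

  boundedBelow-zipWith : (_∙_ : ℤ → ℤ → ℤ) → 0ℤ ∙ 0ℤ ≡ 0ℤ → ∀ {f g} →
    BoundedBelow f → BoundedBelow g → BoundedBelow (λ z → f z ∙ g z)
  boundedBelow-zipWith _∙_ 0∙0≡0 (L , f↓) (M , g↓) =
    L ⊓ M , vanishesBelow-zipWith _∙_ 0∙0≡0 (vanishesBelow-≤ (i⊓j≤i L M) f↓)
                                            (vanishesBelow-≤ (i⊓j≤j L M) g↓)

  -- With G = Σₙ g(n) qⁿ, convolve cs g and p ▹ g are the coefficient functions of
  -- (Σᵢ cs[i] qⁱ) · G and p · G.
  convolve : List ℤ → Coeffs → Coeffs
  convolve []       g z = 0ℤ
  convolve (x ∷ xs) g z = x * g z + convolve xs g (z - 1ℤ)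

  infixr 5 _▹_
  _▹_ : LPoly → Coeffs → Coeffs
  ((o , cs) ▹ g) n = convolve cs g (n - o)

  δ : Coeffs
  δ = coeff oneP

  δ-vanishesBelow : VanishesBelow δ 0ℤ
  δ-vanishesBelow -[1+ n ] _         = refl
  δ-vanishesBelow (+ n)    (+<+ ())

  δ-symmetric : ∀ n → δ (- n) ≡ δ n
  δ-symmetric (+ zero)  = refl
  δ-symmetric (+ suc _) = refl
  δ-symmetric -[1+ _ ]  = refl

  convolve-vanishesBelow : ∀ cs {g L} → VanishesBelow g L → VanishesBelow (convolve cs g) L
  convolve-vanishesBelow []       g↓ z z<L = refl
  convolve-vanishesBelow (x ∷ xs) {g} {L} g↓ z z<L = begin
    x * g z + convolve xs g (z - 1ℤ)  ≡⟨ cong₂ _+_ (cong (x *_) (g↓ z z<L))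
                                           (convolve-vanishesBelow xs g↓ (z - 1ℤ) z-1<L) ⟩
    x * 0ℤ + 0ℤ                       ≡⟨ trans (+-identityʳ _) (*-zeroʳ x) ⟩
    0ℤ                                ∎
    where
    z-1<L : z - 1ℤ < L
    z-1<L = ≤-<-trans (i≤j⇒i-k≤j 1ℤ ≤-refl) z<L

  ▹-vanishesBelow : ∀ p {g L} → VanishesBelow g L → VanishesBelow (p ▹ g) (L + proj₁ p)
  ▹-vanishesBelow (o , cs) {L = L} g↓ n n<L+o =
    convolve-vanishesBelow cs g↓ (n - o) (subst (n - o <_) (L+o-o≡L L o) (+-monoˡ-< (- o) n<L+o))
    where
    L+o-o≡L : ∀ L o → L + o - o ≡ L
    L+o-o≡L = solve-∀

  ▹-boundedBelow : ∀ p {g} → BoundedBelow g → BoundedBelow (p ▹ g)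
  ▹-boundedBelow p (L , g↓) = L + proj₁ p , ▹-vanishesBelow p g↓

  idx≡convolve-δ : ∀ cs m → idx cs m ≡ convolve cs δ (+ m)
  idx≡convolve-δ []       m       = refl
  idx≡convolve-δ (x ∷ xs) zero    = sym (begin
    x * 1ℤ + convolve xs δ -[1+ 0 ]  ≡⟨ cong₂ _+_ (*-identityʳ x)
                                          (convolve-vanishesBelow xs δ-vanishesBelow -[1+ 0 ] -<+) ⟩
    x + 0ℤ                           ≡⟨ +-identityʳ x ⟩
    x                                ∎)
  idx≡convolve-δ (x ∷ xs) (suc m) = sym (begin
    x * 0ℤ + convolve xs δ (+ m)  ≡⟨ cong (_+ convolve xs δ (+ m)) (*-zeroʳ x) ⟩
    0ℤ + convolve xs δ (+ m)      ≡⟨ +-identityˡ _ ⟩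
    convolve xs δ (+ m)           ≡⟨ sym (idx≡convolve-δ xs m) ⟩
    idx xs m                      ∎)

  coeff≡▹δ : ∀ p → coeff p ≗ p ▹ δ
  coeff≡▹δ (o , cs) n with n - o
  ... | + m      = idx≡convolve-δ cs m
  ... | -[1+ m ] = sym (convolve-vanishesBelow cs δ-vanishesBelow -[1+ m ] -<+)

  coeff-vanishesBelow : ∀ p → VanishesBelow (coeff p) (proj₁ p)
  coeff-vanishesBelow p z z<o =
    trans (coeff≡▹δ p z) (▹-vanishesBelow p δ-vanishesBelow z (subst (z <_) (sym (+-identityˡ _)) z<o))

  convolve-cong : ∀ cs {f g} → f ≗ g → convolve cs f ≗ convolve cs g
  convolve-cong []       f≗g z = refl
  convolve-cong (x ∷ xs) f≗g z = cong₂ _+_ (cong (x *_) (f≗g z)) (convolve-cong xs f≗g (z - 1ℤ))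

  convolve-shift : ∀ cs g s z → convolve cs (λ y → g (y + s)) z ≡ convolve cs g (z + s)
  convolve-shift []       g s z = refl
  convolve-shift (x ∷ xs) g s z =
    cong (_+_ (x * g (z + s)))
         (trans (convolve-shift xs g s (z - 1ℤ)) (cong (convolve xs g) (z-1+s≡z+s-1 z s)))
    where
    z-1+s≡z+s-1 : ∀ z s → z - 1ℤ + s ≡ z + s - 1ℤ
    z-1+s≡z+s-1 = solve-∀

  convolve-0 : ∀ cs → convolve cs (const 0ℤ) ≗ const 0ℤ
  convolve-0 []       z = refl
  convolve-0 (x ∷ xs) z = begin
    x * 0ℤ + convolve xs (const 0ℤ) (z - 1ℤ)  ≡⟨ cong₂ _+_ (*-zeroʳ x) (convolve-0 xs (z - 1ℤ)) ⟩
    0ℤ                                        ∎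

  convolve-+ : ∀ cs f g z → convolve cs (λ y → f y + g y) z ≡ convolve cs f z + convolve cs g z
  convolve-+ []       f g z = refl
  convolve-+ (x ∷ xs) f g z = begin
    x * (f z + g z) + convolve xs (λ y → f y + g y) (z - 1ℤ)
      ≡⟨ cong (_+_ (x * (f z + g z))) (convolve-+ xs f g (z - 1ℤ)) ⟩
    x * (f z + g z) + (convolve xs f (z - 1ℤ) + convolve xs g (z - 1ℤ))
      ≡⟨ x*[a+b]+[c+d]≡[x*a+c]+[x*b+d] x (f z) (g z) (convolve xs f (z - 1ℤ)) (convolve xs g (z - 1ℤ)) ⟩
    (x * f z + convolve xs f (z - 1ℤ)) + (x * g z + convolve xs g (z - 1ℤ))  ∎
    where
    x*[a+b]+[c+d]≡[x*a+c]+[x*b+d] : ∀ x a b c d → x * (a + b) + (c + d) ≡ (x * a + c) + (x * b + d)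
    x*[a+b]+[c+d]≡[x*a+c]+[x*b+d] = solve-∀

  convolve-- : ∀ cs f g z → convolve cs (λ y → f y - g y) z ≡ convolve cs f z - convolve cs g z
  convolve-- []       f g z = refl
  convolve-- (x ∷ xs) f g z = begin
    x * (f z - g z) + convolve xs (λ y → f y - g y) (z - 1ℤ)
      ≡⟨ cong (_+_ (x * (f z - g z))) (convolve-- xs f g (z - 1ℤ)) ⟩
    x * (f z - g z) + (convolve xs f (z - 1ℤ) - convolve xs g (z - 1ℤ))
      ≡⟨ x*[a-b]+[c-d]≡[x*a+c]-[x*b+d] x (f z) (g z) (convolve xs f (z - 1ℤ)) (convolve xs g (z - 1ℤ)) ⟩
    (x * f z + convolve xs f (z - 1ℤ)) - (x * g z + convolve xs g (z - 1ℤ))  ∎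
    where
    x*[a-b]+[c-d]≡[x*a+c]-[x*b+d] : ∀ x a b c d → x * (a - b) + (c - d) ≡ (x * a + c) - (x * b + d)
    x*[a-b]+[c-d]≡[x*a+c]-[x*b+d] = solve-∀

  convolve-scale : ∀ cs c f z → convolve cs (λ y → c * f y) z ≡ c * convolve cs f z
  convolve-scale []       c f z = sym (*-zeroʳ c)
  convolve-scale (x ∷ xs) c f z = begin
    x * (c * f z) + convolve xs (λ y → c * f y) (z - 1ℤ)
      ≡⟨ cong (_+_ (x * (c * f z))) (convolve-scale xs c f (z - 1ℤ)) ⟩
    x * (c * f z) + c * convolve xs f (z - 1ℤ)
      ≡⟨ x*[c*a]+c*b≡c*[x*a+b] x c (f z) (convolve xs f (z - 1ℤ)) ⟩
    c * (x * f z + convolve xs f (z - 1ℤ))  ∎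
    where
    x*[c*a]+c*b≡c*[x*a+b] : ∀ x c a b → x * (c * a) + c * b ≡ c * (x * a + b)
    x*[c*a]+c*b≡c*[x*a+b] = solve-∀

  convolve-comm : ∀ xs ys g z → convolve xs (convolve ys g) z ≡ convolve ys (convolve xs g) z
  convolve-comm []       ys g z = sym (convolve-0 ys z)
  convolve-comm (x ∷ xs) ys g z = sym (begin
    convolve ys (λ y → x * g y + convolve xs g (y - 1ℤ)) z
      ≡⟨ convolve-+ ys (λ y → x * g y) (λ y → convolve xs g (y - 1ℤ)) z ⟩
    convolve ys (λ y → x * g y) z + convolve ys (λ y → convolve xs g (y - 1ℤ)) z
      ≡⟨ cong₂ _+_ (convolve-scale ys x g z) (convolve-shift ys (convolve xs g) (- 1ℤ) z) ⟩
    x * convolve ys g z + convolve ys (convolve xs g) (z - 1ℤ)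
      ≡⟨ cong (_+_ (x * convolve ys g z)) (sym (convolve-comm xs ys g (z - 1ℤ))) ⟩
    x * convolve ys g z + convolve xs (convolve ys g) (z - 1ℤ)  ∎)

  convolve-addL : ∀ xs ys g z → convolve (addL xs ys) g z ≡ convolve xs g z + convolve ys g z
  convolve-addL []       ys       g z = sym (+-identityˡ _)
  convolve-addL (x ∷ xs) []       g z = sym (+-identityʳ _)
  convolve-addL (x ∷ xs) (y ∷ ys) g z = begin
    (x + y) * g z + convolve (addL xs ys) g (z - 1ℤ)
      ≡⟨ cong (_+_ ((x + y) * g z)) (convolve-addL xs ys g (z - 1ℤ)) ⟩
    (x + y) * g z + (convolve xs g (z - 1ℤ) + convolve ys g (z - 1ℤ))
      ≡⟨ [x+y]*a+[b+c]≡[x*a+b]+[y*a+c] x y (g z) (convolve xs g (z - 1ℤ)) (convolve ys g (z - 1ℤ)) ⟩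
    (x * g z + convolve xs g (z - 1ℤ)) + (y * g z + convolve ys g (z - 1ℤ))  ∎
    where
    [x+y]*a+[b+c]≡[x*a+b]+[y*a+c] : ∀ x y a b c → (x + y) * a + (b + c) ≡ (x * a + b) + (y * a + c)
    [x+y]*a+[b+c]≡[x*a+b]+[y*a+c] = solve-∀

  convolve-map : ∀ c xs g z → convolve (map (c *_) xs) g z ≡ c * convolve xs g z
  convolve-map c []       g z = sym (*-zeroʳ c)
  convolve-map c (x ∷ xs) g z = begin
    c * x * g z + convolve (map (c *_) xs) g (z - 1ℤ)
      ≡⟨ cong (_+_ (c * x * g z)) (convolve-map c xs g (z - 1ℤ)) ⟩
    c * x * g z + c * convolve xs g (z - 1ℤ)
      ≡⟨ c*x*a+c*b≡c*[x*a+b] c x (g z) (convolve xs g (z - 1ℤ)) ⟩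
    c * (x * g z + convolve xs g (z - 1ℤ))  ∎
    where
    c*x*a+c*b≡c*[x*a+b] : ∀ c x a b → c * x * a + c * b ≡ c * (x * a + b)
    c*x*a+c*b≡c*[x*a+b] = solve-∀

  convolve-mulL : ∀ xs ys g z → convolve (mulL xs ys) g z ≡ convolve xs (convolve ys g) z
  convolve-mulL []       ys g z = refl
  convolve-mulL (x ∷ xs) ys g z = begin
    convolve (addL (map (x *_) ys) (0ℤ ∷ mulL xs ys)) g z
      ≡⟨ convolve-addL (map (x *_) ys) (0ℤ ∷ mulL xs ys) g z ⟩
    convolve (map (x *_) ys) g z + (0ℤ * g z + convolve (mulL xs ys) g (z - 1ℤ))
      ≡⟨ cong₂ _+_ (convolve-map x ys g z) (+-identityˡ _) ⟩
    x * convolve ys g z + convolve (mulL xs ys) g (z - 1ℤ)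
      ≡⟨ cong (_+_ (x * convolve ys g z)) (convolve-mulL xs ys g (z - 1ℤ)) ⟩
    x * convolve ys g z + convolve xs (convolve ys g) (z - 1ℤ)  ∎

  convolve-padding : ∀ d cs g z → convolve (replicate d 0ℤ ++ cs) g z ≡ convolve cs g (z - + d)
  convolve-padding zero    cs g z = cong (convolve cs g) (sym (+-identityʳ z))
  convolve-padding (suc d) cs g z = begin
    0ℤ * g z + convolve (replicate d 0ℤ ++ cs) g (z - 1ℤ)  ≡⟨ +-identityˡ _ ⟩
    convolve (replicate d 0ℤ ++ cs) g (z - 1ℤ)             ≡⟨ convolve-padding d cs g (z - 1ℤ) ⟩
    convolve cs g (z - 1ℤ - + d)                           ≡⟨ cong (convolve cs g) (z-1-d≡z-[1+d] z (+ d)) ⟩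
    convolve cs g (z - + suc d)                            ∎
    where
    z-1-d≡z-[1+d] : ∀ z d → z - 1ℤ - d ≡ z - (1ℤ + d)
    z-1-d≡z-[1+d] = solve-∀

  ▹-cong : ∀ p {f g} → f ≗ g → p ▹ f ≗ p ▹ g
  ▹-cong (o , cs) f≗g n = convolve-cong cs f≗g (n - o)

  ▹-shift : ∀ p g s n → (p ▹ (λ y → g (y + s))) n ≡ (p ▹ g) (n + s)
  ▹-shift (o , cs) g s n = trans (convolve-shift cs g s (n - o)) (cong (convolve cs g) (n-o+s≡n+s-o n o s))
    where
    n-o+s≡n+s-o : ∀ n o s → n - o + s ≡ n + s - o
    n-o+s≡n+s-o = solve-∀

  ▹-+ : ∀ p f g n → (p ▹ (λ y → f y + g y)) n ≡ (p ▹ f) n + (p ▹ g) n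
  ▹-+ (o , cs) f g n = convolve-+ cs f g (n - o)

  ▹-- : ∀ p f g n → (p ▹ (λ y → f y - g y)) n ≡ (p ▹ f) n - (p ▹ g) n
  ▹-- (o , cs) f g n = convolve-- cs f g (n - o)

  ▹-▹ : ∀ o₁ c₁ o₂ c₂ g n →
    ((o₁ , c₁) ▹ (o₂ , c₂) ▹ g) n ≡ convolve c₁ (convolve c₂ g) (n - (o₁ + o₂))
  ▹-▹ o₁ c₁ o₂ c₂ g n =
    trans (convolve-shift c₁ (convolve c₂ g) (- o₂) (n - o₁))
          (cong (convolve c₁ (convolve c₂ g)) (n-a-b≡n-[a+b] n o₁ o₂))
    where
    n-a-b≡n-[a+b] : ∀ n a b → n - a - b ≡ n - (a + b)
    n-a-b≡n-[a+b] = solve-∀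

  ▹-⊗ : ∀ p r g → (p ⊗ r) ▹ g ≗ p ▹ r ▹ g
  ▹-⊗ (o₁ , c₁) (o₂ , c₂) g n =
    trans (convolve-mulL c₁ c₂ g (n - (o₁ + o₂))) (sym (▹-▹ o₁ c₁ o₂ c₂ g n))

  ▹-comm : ∀ p r g → p ▹ r ▹ g ≗ r ▹ p ▹ g
  ▹-comm (o₁ , c₁) (o₂ , c₂) g n = begin
    ((o₁ , c₁) ▹ (o₂ , c₂) ▹ g) n                 ≡⟨ ▹-▹ o₁ c₁ o₂ c₂ g n ⟩
    convolve c₁ (convolve c₂ g) (n - (o₁ + o₂))  ≡⟨ convolve-comm c₁ c₂ g _ ⟩
    convolve c₂ (convolve c₁ g) (n - (o₁ + o₂))  ≡⟨ cong (λ o → convolve c₂ (convolve c₁ g) (n - o)) (+-comm o₁ o₂) ⟩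
    convolve c₂ (convolve c₁ g) (n - (o₂ + o₁))  ≡⟨ sym (▹-▹ o₂ c₂ o₁ c₁ g n) ⟩
    ((o₂ , c₂) ▹ (o₁ , c₁) ▹ g) n                 ∎

  ▹-padTo : ∀ {o} p g n → o ≤ proj₁ p → convolve (padTo o p) g (n - o) ≡ (p ▹ g) n
  ▹-padTo {o} (o₁ , cs) g n o≤o₁ = begin
    convolve (replicate ∣ o₁ - o ∣ 0ℤ ++ cs) g (n - o)  ≡⟨ convolve-padding ∣ o₁ - o ∣ cs g (n - o) ⟩
    convolve cs g (n - o - + ∣ o₁ - o ∣)               ≡⟨ cong (λ d → convolve cs g (n - o - d))
                                                              (0≤i⇒+∣i∣≡i (i≤j⇒0≤j-i o≤o₁)) ⟩
    convolve cs g (n - o - (o₁ - o))                   ≡⟨ cong (convolve cs g) (n-o-[o₁-o]≡n-o₁ n o o₁) ⟩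
    convolve cs g (n - o₁)                             ∎
    where
    n-o-[o₁-o]≡n-o₁ : ∀ n o o₁ → n - o - (o₁ - o) ≡ n - o₁
    n-o-[o₁-o]≡n-o₁ = solve-∀

  ▹-⊕ : ∀ p r g n → ((p ⊕ r) ▹ g) n ≡ (p ▹ g) n + (r ▹ g) n
  ▹-⊕ p@(o₁ , _) r@(o₂ , _) g n =
    trans (convolve-addL (padTo (o₁ ⊓ o₂) p) (padTo (o₁ ⊓ o₂) r) g (n - o₁ ⊓ o₂))
          (cong₂ _+_ (▹-padTo p g n (i⊓j≤i o₁ o₂)) (▹-padTo r g n (i⊓j≤j o₁ o₂)))

  ▹-· : ∀ c p g n → ((c · p) ▹ g) n ≡ c * (p ▹ g) n
  ▹-· c (o , cs) g n = convolve-map c cs g (n - o)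

  oneP-▹ : ∀ g → oneP ▹ g ≗ g
  oneP-▹ g n = begin
    1ℤ * g (n - 0ℤ) + 0ℤ  ≡⟨ +-identityʳ _ ⟩
    1ℤ * g (n - 0ℤ)       ≡⟨ *-identityˡ _ ⟩
    g (n - 0ℤ)            ≡⟨ cong g (+-identityʳ n) ⟩
    g n                   ∎

  coeff-⊗ : ∀ p r → coeff (p ⊗ r) ≗ p ▹ coeff r
  coeff-⊗ p r n = begin
    coeff (p ⊗ r) n      ≡⟨ coeff≡▹δ (p ⊗ r) n ⟩
    ((p ⊗ r) ▹ δ) n      ≡⟨ ▹-⊗ p r δ n ⟩
    (p ▹ r ▹ δ) n        ≡⟨ ▹-cong p (λ m → sym (coeff≡▹δ r m)) n ⟩
    (p ▹ coeff r) n      ∎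

  coeff-⊕ : ∀ p r n → coeff (p ⊕ r) n ≡ coeff p n + coeff r n
  coeff-⊕ p r n = begin
    coeff (p ⊕ r) n              ≡⟨ coeff≡▹δ (p ⊕ r) n ⟩
    ((p ⊕ r) ▹ δ) n              ≡⟨ ▹-⊕ p r δ n ⟩
    (p ▹ δ) n + (r ▹ δ) n        ≡⟨ sym (cong₂ _+_ (coeff≡▹δ p n) (coeff≡▹δ r n)) ⟩
    coeff p n + coeff r n        ∎

  coeff-· : ∀ c p n → coeff (c · p) n ≡ c * coeff p n
  coeff-· c p n = begin
    coeff (c · p) n       ≡⟨ coeff≡▹δ (c · p) n ⟩
    ((c · p) ▹ δ) n       ≡⟨ ▹-· c p δ n ⟩
    c * (p ▹ δ) n         ≡⟨ cong (c *_) (sym (coeff≡▹δ p n)) ⟩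
    c * coeff p n         ∎

  -- Quantum integers

  -- ∂ f is the coefficient function of (q − q⁻¹) · Σₙ f(n) qⁿ, so ∂-qint-▹ below is
  -- (q − q⁻¹)[m+1]_q = q^(m+1) − q^(−m−1).
  ∂ : Coeffs → Coeffs
  ∂ f z = f (z - 1ℤ) - f (z + 1ℤ)

  ∂-cong : ∀ {f g} → f ≗ g → ∂ f ≗ ∂ g
  ∂-cong f≗g z = cong₂ _-_ (f≗g (z - 1ℤ)) (f≗g (z + 1ℤ))

  ∂-+-* : ∀ f c g z → ∂ (λ y → f y + c * g y) z ≡ ∂ f z + c * ∂ g z
  ∂-+-* f c g z = [a+c*d]-[b+c*e]≡[a-b]+c*[d-e] (f (z - 1ℤ)) (f (z + 1ℤ)) c (g (z - 1ℤ)) (g (z + 1ℤ))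
    where
    [a+c*d]-[b+c*e]≡[a-b]+c*[d-e] : ∀ a b c d e → (a + c * d) - (b + c * e) ≡ (a - b) + c * (d - e)
    [a+c*d]-[b+c*e]≡[a-b]+c*[d-e] = solve-∀

  ∂-pascal : ∀ f g s t z → ∂ (λ x → f (x + s) + g (x + t)) z ≡ ∂ f (z + s) + ∂ g (z + t)
  ∂-pascal f g s t z = begin
    (f (z - 1ℤ + s) + g (z - 1ℤ + t)) - (f (z + 1ℤ + s) + g (z + 1ℤ + t))
      ≡⟨ cong₂ _-_ (cong₂ _+_ (cong f (z-1+s≡z+s-1 z s)) (cong g (z-1+s≡z+s-1 z t)))
                   (cong₂ _+_ (cong f (z+1+s≡z+s+1 z s)) (cong g (z+1+s≡z+s+1 z t))) ⟩
    (f (z + s - 1ℤ) + g (z + t - 1ℤ)) - (f (z + s + 1ℤ) + g (z + t + 1ℤ))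
      ≡⟨ [a+b]-[c+d]≡[a-c]+[b-d] (f (z + s - 1ℤ)) (g (z + t - 1ℤ)) (f (z + s + 1ℤ)) (g (z + t + 1ℤ)) ⟩
    ∂ f (z + s) + ∂ g (z + t)  ∎
    where
    z-1+s≡z+s-1 : ∀ z s → z - 1ℤ + s ≡ z + s - 1ℤ
    z-1+s≡z+s-1 = solve-∀
    z+1+s≡z+s+1 : ∀ z s → z + 1ℤ + s ≡ z + s + 1ℤ
    z+1+s≡z+s+1 = solve-∀
    [a+b]-[c+d]≡[a-c]+[b-d] : ∀ a b c d → (a + b) - (c + d) ≡ (a - c) + (b - d)
    [a+b]-[c+d]≡[a-c]+[b-d] = solve-∀

  ∂-at-0 : ∀ {f} → (∀ n → f (- n) ≡ f n) → ∂ f 0ℤ ≡ 0ℤ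
  ∂-at-0 {f} f-symmetric = trans (cong (_- f 1ℤ) (f-symmetric 1ℤ)) (+-inverseʳ (f 1ℤ))

  ∂-antisymmetric : ∀ {f} → (∀ n → f (- n) ≡ f n) → ∀ z → ∂ f (- z) ≡ - ∂ f z
  ∂-antisymmetric {f} f-symmetric z = begin
    f (- z - 1ℤ) - f (- z + 1ℤ)
      ≡⟨ cong₂ _-_ (trans (cong f (-z-1≡-[z+1] z)) (f-symmetric (z + 1ℤ)))
                   (trans (cong f (-z+1≡-[z-1] z)) (f-symmetric (z - 1ℤ))) ⟩
    f (z + 1ℤ) - f (z - 1ℤ)
      ≡⟨ a-b≡-[b-a] (f (z + 1ℤ)) (f (z - 1ℤ)) ⟩
    - (f (z - 1ℤ) - f (z + 1ℤ))  ∎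
    where
    -z-1≡-[z+1] : ∀ z → - z - 1ℤ ≡ - (z + 1ℤ)
    -z-1≡-[z+1] = solve-∀
    -z+1≡-[z-1] : ∀ z → - z + 1ℤ ≡ - (z - 1ℤ)
    -z+1≡-[z-1] = solve-∀
    a-b≡-[b-a] : ∀ a b → a - b ≡ - (b - a)
    a-b≡-[b-a] = solve-∀

  qint-suc-▹ : ∀ m g n → (qint (suc (suc m)) ▹ g) n ≡ g (n + + suc m) + (qint (suc m) ▹ g) (n - 1ℤ)
  qint-suc-▹ m g n = begin
    1ℤ * g (n + + suc m) + (0ℤ * g (n + + suc m - 1ℤ) + convolve (alt m) g (n + + suc m - 1ℤ - 1ℤ))
      ≡⟨ cong₂ _+_ (*-identityˡ (g (n + + suc m)))
                   (+-identityˡ (convolve (alt m) g (n + + suc m - 1ℤ - 1ℤ))) ⟩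
    g (n + + suc m) + convolve (alt m) g (n + + suc m - 1ℤ - 1ℤ)
      ≡⟨ cong (λ z → g (n + + suc m) + convolve (alt m) g z) (n+[1+m]-1-1≡n-1+m n (+ m)) ⟩
    g (n + + suc m) + convolve (alt m) g (n - 1ℤ - - + m)  ∎
    where
    n+[1+m]-1-1≡n-1+m : ∀ n m → n + (1ℤ + m) - 1ℤ - 1ℤ ≡ n - 1ℤ - - m
    n+[1+m]-1-1≡n-1+m = solve-∀

  ∂-qint-▹ : ∀ m g n → ∂ (qint (suc m) ▹ g) n ≡ g (n - + suc m) - g (n + + suc m)
  ∂-qint-▹ zero    g n = cong₂ _-_ (oneP-▹ g (n - 1ℤ)) (oneP-▹ g (n + 1ℤ))
  ∂-qint-▹ (suc m) g n = begin
    (qint (2 ℕ.+ m) ▹ g) (n - 1ℤ) - (qint (2 ℕ.+ m) ▹ g) (n + 1ℤ)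
      ≡⟨ cong₂ _-_ (qint-suc-▹ m g (n - 1ℤ)) (qint-suc-▹ m g (n + 1ℤ)) ⟩
    (g (n - 1ℤ + S) + Q (n - 1ℤ - 1ℤ)) - (g (n + 1ℤ + S) + Q (n + 1ℤ - 1ℤ))
      ≡⟨ cong (λ z → (g (n - 1ℤ + S) + Q (n - 1ℤ - 1ℤ)) - (g (n + 1ℤ + S) + Q z)) (n+1-1≡n-1+1 n) ⟩
    (g (n - 1ℤ + S) + Q (n - 1ℤ - 1ℤ)) - (g (n + 1ℤ + S) + Q (n - 1ℤ + 1ℤ))
      ≡⟨ [a+b]-[c+d]≡[b-d]+a-c (g (n - 1ℤ + S)) (Q (n - 1ℤ - 1ℤ)) (g (n + 1ℤ + S)) (Q (n - 1ℤ + 1ℤ)) ⟩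
    (Q (n - 1ℤ - 1ℤ) - Q (n - 1ℤ + 1ℤ)) + g (n - 1ℤ + S) - g (n + 1ℤ + S)
      ≡⟨ cong (λ d → d + g (n - 1ℤ + S) - g (n + 1ℤ + S)) (∂-qint-▹ m g (n - 1ℤ)) ⟩
    (g (n - 1ℤ - S) - g (n - 1ℤ + S)) + g (n - 1ℤ + S) - g (n + 1ℤ + S)
      ≡⟨ [a-b]+b-c≡a-c (g (n - 1ℤ - S)) (g (n - 1ℤ + S)) (g (n + 1ℤ + S)) ⟩
    g (n - 1ℤ - S) - g (n + 1ℤ + S)
      ≡⟨ cong₂ (λ x y → g x - g y) (n-1-s≡n-[1+s] n S) (+-assoc n 1ℤ S) ⟩
    g (n - + suc (suc m)) - g (n + + suc (suc m))  ∎
    where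
    S = + suc m
    Q = qint (suc m) ▹ g
    n+1-1≡n-1+1 : ∀ n → n + 1ℤ - 1ℤ ≡ n - 1ℤ + 1ℤ
    n+1-1≡n-1+1 = solve-∀
    [a+b]-[c+d]≡[b-d]+a-c : ∀ a b c d → (a + b) - (c + d) ≡ (b - d) + a - c
    [a+b]-[c+d]≡[b-d]+a-c = solve-∀
    [a-b]+b-c≡a-c : ∀ a b c → (a - b) + b - c ≡ a - c
    [a-b]+b-c≡a-c = solve-∀
    n-1-s≡n-[1+s] : ∀ n s → n - 1ℤ - s ≡ n - (1ℤ + s)
    n-1-s≡n-[1+s] = solve-∀

  qint-pascal : ∀ a b E n →
    (qint (suc a ℕ.+ suc b) ▹ E) n ≡ (qint (suc b) ▹ E) (n - + suc a) + (qint (suc a) ▹ E) (n + + suc b)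
  qint-pascal zero    b E n = begin
    (qint (2 ℕ.+ b) ▹ E) n                       ≡⟨ qint-suc-▹ b E n ⟩
    E (n + + suc b) + (qint (suc b) ▹ E) (n - 1ℤ)  ≡⟨ +-comm (E (n + + suc b)) _ ⟩
    (qint (suc b) ▹ E) (n - 1ℤ) + E (n + + suc b)  ≡⟨ cong (_+_ ((qint (suc b) ▹ E) (n - 1ℤ)))
                                                        (sym (oneP-▹ E (n + + suc b))) ⟩
    (qint (suc b) ▹ E) (n - 1ℤ) + (oneP ▹ E) (n + + suc b)  ∎
  qint-pascal (suc a) b E n = begin
    (qint (suc (suc a ℕ.+ suc b)) ▹ E) n
      ≡⟨ qint-suc-▹ (a ℕ.+ suc b) E n ⟩
    E (n + + suc (a ℕ.+ suc b)) + (qint (suc a ℕ.+ suc b) ▹ E) (n - 1ℤ)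
      ≡⟨ cong (_+_ (E (n + + suc (a ℕ.+ suc b)))) (qint-pascal a b E (n - 1ℤ)) ⟩
    E (n + + suc (a ℕ.+ suc b)) + (Qb (n - 1ℤ - + suc a) + Qa (n - 1ℤ + + suc b))
      ≡⟨ cong₂ (λ x y → E x + (Qb y + Qa (n - 1ℤ + + suc b)))
               (n+[1+[a+[1+b]]]≡n+[1+b]+[1+a] n (+ a) (+ b)) (n-1-[1+a]≡n-[1+[1+a]] n (+ a)) ⟩
    E (n + + suc b + + suc a) + (Qb (n - + suc (suc a)) + Qa (n - 1ℤ + + suc b))
      ≡⟨ cong (λ x → E (n + + suc b + + suc a) + (Qb (n - + suc (suc a)) + Qa x)) (n-1+[1+b]≡n+[1+b]-1 n (+ b)) ⟩
    E (n + + suc b + + suc a) + (Qb (n - + suc (suc a)) + Qa (n + + suc b - 1ℤ))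
      ≡⟨ x+[y+z]≡y+[x+z] (E (n + + suc b + + suc a)) (Qb (n - + suc (suc a))) (Qa (n + + suc b - 1ℤ)) ⟩
    Qb (n - + suc (suc a)) + (E (n + + suc b + + suc a) + Qa (n + + suc b - 1ℤ))
      ≡⟨ cong (_+_ (Qb (n - + suc (suc a)))) (sym (qint-suc-▹ a E (n + + suc b))) ⟩
    Qb (n - + suc (suc a)) + (qint (suc (suc a)) ▹ E) (n + + suc b)  ∎
    where
    Qa = qint (suc a) ▹ E
    Qb = qint (suc b) ▹ E
    n+[1+[a+[1+b]]]≡n+[1+b]+[1+a] : ∀ n a b → n + (1ℤ + (a + (1ℤ + b))) ≡ n + (1ℤ + b) + (1ℤ + a)
    n+[1+[a+[1+b]]]≡n+[1+b]+[1+a] = solve-∀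
    n-1-[1+a]≡n-[1+[1+a]] : ∀ n a → n - 1ℤ - (1ℤ + a) ≡ n - (1ℤ + (1ℤ + a))
    n-1-[1+a]≡n-[1+[1+a]] = solve-∀
    n-1+[1+b]≡n+[1+b]-1 : ∀ n b → n - 1ℤ + (1ℤ + b) ≡ n + (1ℤ + b) - 1ℤ
    n-1+[1+b]≡n+[1+b]-1 = solve-∀
    x+[y+z]≡y+[x+z] : ∀ x y z → x + (y + z) ≡ y + (x + z)
    x+[y+z]≡y+[x+z] = solve-∀

  -- Cancelling q-factorials

  periodic-vanishesBelow⇒≗0 : ∀ {f L} p → (∀ z → f z ≡ f (z - + suc p)) → VanishesBelow f L →
    f ≗ const 0ℤ
  periodic-vanishesBelow⇒≗0 {f} {L} p periodic f↓ z =
    let (t , z-L<t) = exceeding-ℕ (z - L) in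
    vanishesBelow-L+t t z (subst (_< L + + t) (L+[z-L]≡z L z) (+-monoʳ-< L z-L<t))
    where
    exceeding-ℕ : ∀ d → ∃ λ t → d < + t
    exceeding-ℕ (+ t)    = suc t , +<+ (ℕₚ.n<1+n t)
    exceeding-ℕ -[1+ _ ] = 0 , -<+
    L+[z-L]≡z : ∀ L z → L + (z - L) ≡ z
    L+[z-L]≡z = solve-∀
    vanishesBelow-L+t : ∀ t → VanishesBelow f (L + + t)
    vanishesBelow-L+t zero    y y<L+0   = f↓ y (subst (y <_) (+-identityʳ L) y<L+0)
    vanishesBelow-L+t (suc t) y y<L+t+1 =
      trans (periodic y) (vanishesBelow-L+t t (y - + suc p) (≤-<-trans y-p-1≤y-1 y-1<L+t))
      where
      L+[1+t]-1≡L+t : ∀ L t → L + (1ℤ + t) - 1ℤ ≡ L + t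
      L+[1+t]-1≡L+t = solve-∀
      y-[1+p]≡y-1-p : ∀ y p → y - (1ℤ + p) ≡ y - 1ℤ - p
      y-[1+p]≡y-1-p = solve-∀
      y-1<L+t : y - 1ℤ < L + + t
      y-1<L+t = subst (y - 1ℤ <_) (L+[1+t]-1≡L+t L (+ t)) (+-monoˡ-< (- 1ℤ) y<L+t+1)
      y-p-1≤y-1 : y - + suc p ≤ y - 1ℤ
      y-p-1≤y-1 = subst (_≤ y - 1ℤ) (sym (y-[1+p]≡y-1-p y (+ p))) (i≤j⇒i-k≤j (+ p) ≤-refl)

  qint-cancel : ∀ m {E} → BoundedBelow E → qint (suc m) ▹ E ≗ const 0ℤ → E ≗ const 0ℤ
  qint-cancel m {E} (L , E↓) Q▹E≗0 = periodic-vanishesBelow⇒≗0 (m ℕ.+ suc m) periodic E↓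
    where
    S = + suc m
    z≡z-s+s : ∀ z s → z ≡ z - s + s
    z≡z-s+s = solve-∀
    z-[1+m]-[1+m]≡z-[1+[m+[1+m]]] : ∀ z m → z - (1ℤ + m) - (1ℤ + m) ≡ z - (1ℤ + (m + (1ℤ + m)))
    z-[1+m]-[1+m]≡z-[1+[m+[1+m]]] = solve-∀
    ∂Q▹E≡0 : ∀ n → E (n - S) - E (n + S) ≡ 0ℤ
    ∂Q▹E≡0 n = begin
      E (n - S) - E (n + S)       ≡⟨ sym (∂-qint-▹ m E n) ⟩
      ∂ (qint (suc m) ▹ E) n      ≡⟨ cong₂ _-_ (Q▹E≗0 (n - 1ℤ)) (Q▹E≗0 (n + 1ℤ)) ⟩
      0ℤ                          ∎
    periodic : ∀ z → E z ≡ E (z - + suc (m ℕ.+ suc m))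
    periodic z = begin
      E z                          ≡⟨ cong E (z≡z-s+s z S) ⟩
      E (z - S + S)                ≡⟨ sym (i-j≡0⇒i≡j _ _ (∂Q▹E≡0 (z - S))) ⟩
      E (z - S - S)                ≡⟨ cong E (z-[1+m]-[1+m]≡z-[1+[m+[1+m]]] z (+ m)) ⟩
      E (z - + suc (m ℕ.+ suc m))  ∎

  qfact-cancel : ∀ w {D} → BoundedBelow D → qfact w ▹ D ≗ const 0ℤ → D ≗ const 0ℤ
  qfact-cancel zero    {D} _  qfact▹D≗0 n = trans (sym (oneP-▹ D n)) (qfact▹D≗0 n)
  qfact-cancel (suc w) {D} D↓ qfact▹D≗0 =
    qfact-cancel w D↓ (qint-cancel w (▹-boundedBelow (qfact w) D↓)
      (λ n → trans (sym (▹-⊗ (qint (suc w)) (qfact w) D n)) (qfact▹D≗0 n)))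

  IsQBinomCoeffs : ℕ → ℕ → Coeffs → Set
  IsQBinomCoeffs w h f = BoundedBelow f × (qfact w ▹ f ≗ coeff (qfalling (w ℕ.+ h) w))

  isQBinomCoeffs-unique : ∀ w h {f g} → IsQBinomCoeffs w h f → IsQBinomCoeffs w h g → f ≗ g
  isQBinomCoeffs-unique w h {f} {g} (f↓ , qfact▹f) (g↓ , qfact▹g) n =
    i-j≡0⇒i≡j (f n) (g n) (qfact-cancel w (boundedBelow-zipWith _-_ refl f↓ g↓) qfact▹[f-g]≗0 n)
    where
    qfact▹[f-g]≗0 : qfact w ▹ (λ y → f y - g y) ≗ const 0ℤ
    qfact▹[f-g]≗0 m = begin
      (qfact w ▹ (λ y → f y - g y)) m       ≡⟨ ▹-- (qfact w) f g m ⟩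
      (qfact w ▹ f) m - (qfact w ▹ g) m     ≡⟨ cong₂ _-_ (qfact▹f m) (qfact▹g m) ⟩
      coeff F m - coeff F m                 ≡⟨ +-inverseʳ (coeff F m) ⟩
      0ℤ                                    ∎
      where
      F = qfalling (w ℕ.+ h) w

  isQBinom⇒isQBinomCoeffs : ∀ w h P → IsQBinom (w ℕ.+ h) w P → IsQBinomCoeffs w h (coeff P)
  isQBinom⇒isQBinomCoeffs w h P qfact⊗P≈qfalling =
    (proj₁ P , coeff-vanishesBelow P) , λ n → trans (sym (coeff-⊗ (qfact w) P n)) (qfact⊗P≈qfalling n)

  -- The coefficients of q-binomials

  qfalling-suc : ∀ n j → coeff (qfalling (suc n) (suc j)) ≗ qint (suc n) ▹ coeff (qfalling n j)
  qfalling-suc n zero    = coeff-⊗ (qint (suc n)) oneP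
  qfalling-suc n (suc j) m = begin
    coeff (Q ⊗ qfalling (suc n) (suc j)) m              ≡⟨ coeff-⊗ Q (qfalling (suc n) (suc j)) m ⟩
    (Q ▹ coeff (qfalling (suc n) (suc j))) m            ≡⟨ ▹-cong Q (qfalling-suc n j) m ⟩
    (Q ▹ qint (suc n) ▹ coeff (qfalling n j)) m         ≡⟨ ▹-comm Q (qint (suc n)) _ m ⟩
    (qint (suc n) ▹ Q ▹ coeff (qfalling n j)) m         ≡⟨ ▹-cong (qint (suc n)) (λ y → sym (coeff-⊗ Q _ y)) m ⟩
    (qint (suc n) ▹ coeff (Q ⊗ qfalling n j)) m         ∎
    where
    Q = qint (n ℕ.∸ j)

  qfact≈qfalling : ∀ w → qfact w ≈ qfalling w w
  qfact≈qfalling zero    n = refl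
  qfact≈qfalling (suc w) n = begin
    coeff (qint (suc w) ⊗ qfact w) n           ≡⟨ coeff-⊗ (qint (suc w)) (qfact w) n ⟩
    (qint (suc w) ▹ coeff (qfact w)) n         ≡⟨ ▹-cong (qint (suc w)) (qfact≈qfalling w) n ⟩
    (qint (suc w) ▹ coeff (qfalling w w)) n    ≡⟨ sym (qfalling-suc w w n) ⟩
    coeff (qfalling (suc w) (suc w)) n         ∎

  qfalling-pascal : ∀ w h →
    coeff (qfalling (suc w ℕ.+ h) (suc w)) ≗ qint (suc h) ▹ coeff (qfalling (w ℕ.+ suc h) w)
  qfalling-pascal w h n = begin
    coeff (qfalling (suc w ℕ.+ h) (suc w)) n
      ≡⟨ coeff-⊗ (qint (suc w ℕ.+ h ℕ.∸ w)) _ n ⟩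
    (qint (suc w ℕ.+ h ℕ.∸ w) ▹ coeff (qfalling (suc w ℕ.+ h) w)) n
      ≡⟨ cong (λ m → (qint (m ℕ.∸ w) ▹ coeff (qfalling m w)) n) (sym (ℕₚ.+-suc w h)) ⟩
    (qint (w ℕ.+ suc h ℕ.∸ w) ▹ coeff (qfalling (w ℕ.+ suc h) w)) n
      ≡⟨ cong (λ m → (qint m ▹ coeff (qfalling (w ℕ.+ suc h) w)) n) (ℕₚ.m+n∸m≡n w (suc h)) ⟩
    (qint (suc h) ▹ coeff (qfalling (w ℕ.+ suc h) w)) n  ∎

  isQBinomCoeffs-pascal : ∀ w h {f₂ f₁} s t →
    (∀ E n → (qint (suc w ℕ.+ suc h) ▹ E) n ≡ (qint (suc h) ▹ E) (n + s) + (qint (suc w) ▹ E) (n + t)) →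
    IsQBinomCoeffs (suc w) h f₂ → IsQBinomCoeffs w (suc h) f₁ →
    IsQBinomCoeffs (suc w) (suc h) (λ n → f₂ (n + s) + f₁ (n + t))
  isQBinomCoeffs-pascal w h {f₂} {f₁} s t qint-split (f₂↓ , qfact▹f₂) (f₁↓ , qfact▹f₁) =
    boundedBelow-zipWith _+_ refl (boundedBelow-shift s f₂↓) (boundedBelow-shift t f₁↓) , λ n → begin
      (F ▹ (λ y → f₂ (y + s) + f₁ (y + t))) n
        ≡⟨ ▹-+ F (λ y → f₂ (y + s)) (λ y → f₁ (y + t)) n ⟩
      (F ▹ (λ y → f₂ (y + s))) n + (F ▹ (λ y → f₁ (y + t))) n
        ≡⟨ cong₂ _+_ (▹-shift F f₂ s n) (▹-shift F f₁ t n) ⟩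
      (F ▹ f₂) (n + s) + (F ▹ f₁) (n + t)
        ≡⟨ cong₂ _+_ (qfact▹f₂ (n + s)) (▹-⊗ (qint (suc w)) (qfact w) f₁ (n + t)) ⟩
      coeff (qfalling (suc w ℕ.+ h) (suc w)) (n + s) + (qint (suc w) ▹ qfact w ▹ f₁) (n + t)
        ≡⟨ cong₂ _+_ (qfalling-pascal w h (n + s)) (▹-cong (qint (suc w)) qfact▹f₁ (n + t)) ⟩
      (qint (suc h) ▹ E) (n + s) + (qint (suc w) ▹ E) (n + t)
        ≡⟨ sym (qint-split E n) ⟩
      (qint (suc w ℕ.+ suc h) ▹ E) n
        ≡⟨ sym (qfalling-suc (w ℕ.+ suc h) w n) ⟩
      coeff (qfalling (suc w ℕ.+ suc h) (suc w)) n  ∎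
    where
    F = qfact (suc w)
    E = coeff (qfalling (w ℕ.+ suc h) w)

  -- qbinom w h n is the coefficient of qⁿ in [w+h over w]_q, through the q-Pascal rule
  -- [w+h over w] = q^w [w+h−1 over w] + q^(−h) [w+h−1 over w−1].
  qbinom : ℕ → ℕ → Coeffs
  qbinom zero    h       = δ
  qbinom (suc w) zero    = δ
  qbinom (suc w) (suc h) n = qbinom (suc w) h (n - + suc w) + qbinom w (suc h) (n + + suc h)

  δ-isQBinomCoeffs : ∀ w → IsQBinomCoeffs w 0 δ
  δ-isQBinomCoeffs w = (0ℤ , δ-vanishesBelow) , λ n → begin
    (qfact w ▹ δ) n                  ≡⟨ sym (coeff≡▹δ (qfact w) n) ⟩
    coeff (qfact w) n                ≡⟨ qfact≈qfalling w n ⟩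
    coeff (qfalling w w) n           ≡⟨ cong (λ m → coeff (qfalling m w) n) (sym (ℕₚ.+-identityʳ w)) ⟩
    coeff (qfalling (w ℕ.+ 0) w) n   ∎

  qbinom-isQBinomCoeffs : ∀ w h → IsQBinomCoeffs w h (qbinom w h)
  qbinom-isQBinomCoeffs zero    h       = (0ℤ , δ-vanishesBelow) , oneP-▹ δ
  qbinom-isQBinomCoeffs (suc w) zero    = δ-isQBinomCoeffs (suc w)
  qbinom-isQBinomCoeffs (suc w) (suc h) =
    isQBinomCoeffs-pascal w h (- + suc w) (+ suc h) (qint-pascal w h)
      (qbinom-isQBinomCoeffs (suc w) h) (qbinom-isQBinomCoeffs w (suc h))

  qbinom-pascal₂ : ∀ w h n →
    qbinom (suc w) (suc h) n ≡ qbinom (suc w) h (n + + suc w) + qbinom w (suc h) (n - + suc h)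
  qbinom-pascal₂ w h = isQBinomCoeffs-unique (suc w) (suc h) (qbinom-isQBinomCoeffs (suc w) (suc h))
    (isQBinomCoeffs-pascal w h (+ suc w) (- + suc h) qint-split
      (qbinom-isQBinomCoeffs (suc w) h) (qbinom-isQBinomCoeffs w (suc h)))
    where
    qint-split : ∀ E n → (qint (suc w ℕ.+ suc h) ▹ E) n ≡
      (qint (suc h) ▹ E) (n + + suc w) + (qint (suc w) ▹ E) (n - + suc h)
    qint-split E n = begin
      (qint (suc w ℕ.+ suc h) ▹ E) n
        ≡⟨ cong (λ m → (qint m ▹ E) n) (ℕₚ.+-comm (suc w) (suc h)) ⟩
      (qint (suc h ℕ.+ suc w) ▹ E) n
        ≡⟨ qint-pascal h w E n ⟩
      (qint (suc w) ▹ E) (n - + suc h) + (qint (suc h) ▹ E) (n + + suc w)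
        ≡⟨ +-comm ((qint (suc w) ▹ E) (n - + suc h)) _ ⟩
      (qint (suc h) ▹ E) (n + + suc w) + (qint (suc w) ▹ E) (n - + suc h)  ∎

  qbinom-symmetric : ∀ w h n → qbinom w h (- n) ≡ qbinom w h n
  qbinom-symmetric zero    h       = δ-symmetric
  qbinom-symmetric (suc w) zero    = δ-symmetric
  qbinom-symmetric (suc w) (suc h) n = begin
    qbinom (suc w) h (- n - + suc w) + qbinom w (suc h) (- n + + suc h)
      ≡⟨ cong₂ _+_ (cong (qbinom (suc w) h) (-n-s≡-[n+s] n (+ suc w)))
                   (cong (qbinom w (suc h)) (-n+s≡-[n-s] n (+ suc h))) ⟩
    qbinom (suc w) h (- (n + + suc w)) + qbinom w (suc h) (- (n - + suc h))
      ≡⟨ cong₂ _+_ (qbinom-symmetric (suc w) h _) (qbinom-symmetric w (suc h) _) ⟩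
    qbinom (suc w) h (n + + suc w) + qbinom w (suc h) (n - + suc h)
      ≡⟨ sym (qbinom-pascal₂ w h n) ⟩
    qbinom (suc w) (suc h) n  ∎
    where
    -n-s≡-[n+s] : ∀ n s → - n - s ≡ - (n + s)
    -n-s≡-[n+s] = solve-∀
    -n+s≡-[n-s] : ∀ n s → - n + s ≡ - (n - s)
    -n+s≡-[n-s] = solve-∀

  qbinom-transpose : ∀ w h → qbinom w h ≗ qbinom h w
  qbinom-transpose zero    zero    n = refl
  qbinom-transpose zero    (suc h) n = refl
  qbinom-transpose (suc w) zero    n = refl
  qbinom-transpose (suc w) (suc h) n = begin
    qbinom (suc w) (suc h) n
      ≡⟨ qbinom-pascal₂ w h n ⟩
    qbinom (suc w) h (n + + suc w) + qbinom w (suc h) (n - + suc h)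
      ≡⟨ cong₂ _+_ (qbinom-transpose (suc w) h _) (qbinom-transpose w (suc h) _) ⟩
    qbinom h (suc w) (n + + suc w) + qbinom (suc h) w (n - + suc h)
      ≡⟨ +-comm (qbinom h (suc w) (n + + suc w)) _ ⟩
    qbinom (suc h) (suc w) n  ∎

  qbinom-vanishesBelow : ∀ w h → VanishesBelow (qbinom w h) (- + (w ℕ.* h))
  qbinom-vanishesBelow zero    h       = δ-vanishesBelow
  qbinom-vanishesBelow (suc w) zero    =
    subst (λ m → VanishesBelow δ (- + m)) (sym (ℕₚ.*-zeroʳ (suc w))) δ-vanishesBelow
  qbinom-vanishesBelow (suc w) (suc h) = vanishesBelow-zipWith _+_ refl
    (vanishesBelow-≤ -WH≤-Wh+W (vanishesBelow-shift (- W) (qbinom-vanishesBelow (suc w) h)))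
    (vanishesBelow-≤ (≤-reflexive -WH≡-wH-H) (vanishesBelow-shift H (qbinom-vanishesBelow w (suc h))))
    where
    W = + suc w
    H = + suc h
    -+[m*n]≡-[m*n] : ∀ m n → - + (m ℕ.* n) ≡ - (+ m * + n)
    -+[m*n]≡-[m*n] m n = cong -_ (pos-* m n)
    -[W*[1+h]]≡-[W*h]+W-[W+W] : ∀ W h → - (W * (1ℤ + h)) ≡ - (W * h) - - W - (W + W)
    -[W*[1+h]]≡-[W*h]+W-[W+W] = solve-∀
    -[[1+w]*H]≡-[w*H]-H : ∀ w H → - ((1ℤ + w) * H) ≡ - (w * H) - H
    -[[1+w]*H]≡-[w*H]-H = solve-∀
    -WH≤-Wh+W : - + (suc w ℕ.* suc h) ≤ - + (suc w ℕ.* h) - - W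
    -WH≤-Wh+W = subst (_≤ - + (suc w ℕ.* h) - - W) (sym (begin
      - + (suc w ℕ.* suc h)                ≡⟨ -+[m*n]≡-[m*n] (suc w) (suc h) ⟩
      - (W * H)                            ≡⟨ -[W*[1+h]]≡-[W*h]+W-[W+W] W (+ h) ⟩
      - (W * + h) - - W - (W + W)          ≡⟨ cong (λ x → x - - W - (W + W)) (sym (-+[m*n]≡-[m*n] (suc w) h)) ⟩
      - + (suc w ℕ.* h) - - W - (W + W)    ∎))
      (i≤j⇒i-k≤j (W + W) ≤-refl)
    -WH≡-wH-H : - + (suc w ℕ.* suc h) ≡ - + (w ℕ.* suc h) - H
    -WH≡-wH-H = begin
      - + (suc w ℕ.* suc h)  ≡⟨ -+[m*n]≡-[m*n] (suc w) (suc h) ⟩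
      - (W * H)              ≡⟨ -[[1+w]*H]≡-[w*H]-H (+ w) H ⟩
      - (+ w * H) - H        ≡⟨ cong (_- H) (sym (-+[m*n]≡-[m*n] w (suc h))) ⟩
      - + (w ℕ.* suc h) - H  ∎

  qbinom-vanishesAbove : ∀ w h j → w ℕ.* h ℕ.< j → qbinom w h (+ j) ≡ 0ℤ
  qbinom-vanishesAbove w h j wh<j =
    trans (sym (qbinom-symmetric w h (+ j))) (qbinom-vanishesBelow w h (- + j) (neg-mono-< (+<+ wh<j)))

  -- Expansion in quantum integers

  δ-⊖-≢ : ∀ k N → k ≢ N → δ (k ⊖ N) ≡ 0ℤ
  δ-⊖-≢ zero    zero    0≢0 = ⊥-elim (0≢0 refl)
  δ-⊖-≢ zero    (suc N) _   = refl
  δ-⊖-≢ (suc k) zero    _   = refl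
  δ-⊖-≢ (suc k) (suc N) k≢N = trans (cong δ ([1+m]⊖[1+n]≡m⊖n k N)) (δ-⊖-≢ k N (k≢N ∘ cong suc))

  ∂-coeff-qint : ∀ N k → ∂ (coeff (qint (suc N))) (+ suc k) ≡ δ (k ⊖ N)
  ∂-coeff-qint N k = begin
    ∂ (coeff (qint (suc N))) (+ suc k)  ≡⟨ ∂-cong (coeff≡▹δ (qint (suc N))) (+ suc k) ⟩
    ∂ (qint (suc N) ▹ δ) (+ suc k)      ≡⟨ ∂-qint-▹ N δ (+ suc k) ⟩
    δ (suc k ⊖ suc N) - 0ℤ              ≡⟨ +-identityʳ (δ (suc k ⊖ suc N)) ⟩
    δ (suc k ⊖ suc N)                   ≡⟨ cong δ ([1+m]⊖[1+n]≡m⊖n k N) ⟩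
    δ (k ⊖ N)                           ∎

  ∂-sumQ-suc : ∀ a N k {x d} → ∂ (coeff (sumQ N a)) (+ suc k) ≡ x → δ (k ⊖ N) ≡ d →
    ∂ (coeff (sumQ (suc N) a)) (+ suc k) ≡ x + a (suc N) * d
  ∂-sumQ-suc a N k {x} {d} ∂S≡x δ≡d = begin
    ∂ (coeff (sumQ (suc N) a)) (+ suc k)
      ≡⟨ ∂-cong coeff-sumQ-suc (+ suc k) ⟩
    ∂ (λ y → coeff (sumQ N a) y + a (suc N) * coeff (qint (suc N)) y) (+ suc k)
      ≡⟨ ∂-+-* (coeff (sumQ N a)) (a (suc N)) (coeff (qint (suc N))) (+ suc k) ⟩
    ∂ (coeff (sumQ N a)) (+ suc k) + a (suc N) * ∂ (coeff (qint (suc N))) (+ suc k)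
      ≡⟨ cong₂ (λ x d → x + a (suc N) * d) ∂S≡x (trans (∂-coeff-qint N k) δ≡d) ⟩
    x + a (suc N) * d  ∎
    where
    coeff-sumQ-suc : coeff (sumQ (suc N) a) ≗ λ y → coeff (sumQ N a) y + a (suc N) * coeff (qint (suc N)) y
    coeff-sumQ-suc y = trans (coeff-⊕ (sumQ N a) (a (suc N) · qint (suc N)) y)
                             (cong (_+_ (coeff (sumQ N a) y)) (coeff-· (a (suc N)) (qint (suc N)) y))

  ∂-sumQ : ∀ a N k → (k ℕ.< N → ∂ (coeff (sumQ N a)) (+ suc k) ≡ a (suc k))
                   × (N ℕ.≤ k → ∂ (coeff (sumQ N a)) (+ suc k) ≡ 0ℤ)
  ∂-sumQ a zero    k = (λ ()) , λ _ → refl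
  ∂-sumQ a (suc N) k with ℕₚ.<-cmp k N
  ... | tri< k<N _ _ =
        (λ _ → trans (∂-sumQ-suc a N k (proj₁ (∂-sumQ a N k) k<N) (δ-⊖-≢ k N (ℕₚ.<⇒≢ k<N)))
                     (trans (cong (_+_ (a (suc k))) (*-zeroʳ (a (suc N)))) (+-identityʳ (a (suc k)))))
      , (λ N<k → ⊥-elim (ℕₚ.<-asym k<N (ℕₚ.<-≤-trans (ℕₚ.n<1+n N) N<k)))
  ... | tri≈ _ refl _ =
        (λ _ → trans (∂-sumQ-suc a N k (proj₂ (∂-sumQ a N k) ℕₚ.≤-refl) (cong δ (n⊖n≡0 k)))
                     (trans (+-identityˡ _) (*-identityʳ (a (suc k)))))
      , (λ k<k → ⊥-elim (ℕₚ.n≮n k k<k))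
  ... | tri> _ _ N<k =
        (λ k<N+1 → ⊥-elim (ℕₚ.<⇒≱ N<k (ℕₚ.≤-pred k<N+1)))
      , (λ _ → trans (∂-sumQ-suc a N k (proj₂ (∂-sumQ a N k) (ℕₚ.<⇒≤ N<k)) (δ-⊖-≢ k N (ℕₚ.<⇒≢ N<k ∘ sym)))
                     (trans (+-identityˡ _) (*-zeroʳ (a (suc N)))))

  ∂-sumQ-of-support : ∀ a N → (∀ k → N ℕ.< k → a k ≡ 0ℤ) →
    ∀ k → ∂ (coeff (sumQ N a)) (+ suc k) ≡ a (suc k)
  ∂-sumQ-of-support a N a-support k with k ℕ.<? N
  ... | yes k<N = proj₁ (∂-sumQ a N k) k<N
  ... | no  k≮N = trans (proj₂ (∂-sumQ a N k) N≤k) (sym (a-support (suc k) (ℕ.s≤s N≤k)))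
    where
    N≤k = ℕₚ.≮⇒≥ k≮N

  coeffSeq-∂ : ∀ w h {a} → IsCoeffSeq w h a → a ≗ ∂ (qbinom w h) ∘ +_
  coeffSeq-∂ w h (a0≡0 , _) zero = trans a0≡0 (sym (∂-at-0 (qbinom-symmetric w h)))
  coeffSeq-∂ w h {a} (_ , N , a-support , isQBinom) (suc k) = begin
    a (suc k)                        ≡⟨ sym (∂-sumQ-of-support a N a-support k) ⟩
    ∂ (coeff (sumQ N a)) (+ suc k)   ≡⟨ ∂-cong sumQ≗qbinom (+ suc k) ⟩
    ∂ (qbinom w h) (+ suc k)         ∎
    where
    sumQ≗qbinom : coeff (sumQ N a) ≗ qbinom w h
    sumQ≗qbinom = isQBinomCoeffs-unique w h
      (isQBinom⇒isQBinomCoeffs w h (sumQ N a) isQBinom) (qbinom-isQBinomCoeffs w h)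

  coeffSeq-∂ᵀ : ∀ w h {a} → IsCoeffSeq w h a → a ≗ ∂ (qbinom h w) ∘ +_
  coeffSeq-∂ᵀ w h isCoeffSeq m = trans (coeffSeq-∂ w h isCoeffSeq m) (∂-cong (qbinom-transpose w h) (+ m))

  ∂-sub-≥ : ∀ f {a} → a ≗ ∂ f ∘ +_ → ∀ {k w} → w ℕ.≤ k → ∂ f (+ k - + w) ≡ a (k ℕ.∸ w)
  ∂-sub-≥ f {a} a≗∂f {k} {w} w≤k = begin
    ∂ f (+ k - + w)      ≡⟨ cong (∂ f) (trans (m-n≡m⊖n k w) (⊖-≥ w≤k)) ⟩
    ∂ f (+ (k ℕ.∸ w))    ≡⟨ sym (a≗∂f (k ℕ.∸ w)) ⟩
    a (k ℕ.∸ w)          ∎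

  ∂-sub-≤ : ∀ f {a} → a ≗ ∂ f ∘ +_ → (∀ n → f (- n) ≡ f n) → ∀ {k w} → k ℕ.≤ w →
    ∂ f (+ k - + w) ≡ - a (w ℕ.∸ k)
  ∂-sub-≤ f {a} a≗∂f f-symmetric {k} {w} k≤w = begin
    ∂ f (+ k - + w)          ≡⟨ cong (∂ f) (trans (m-n≡m⊖n k w) (⊖-≤ k≤w)) ⟩
    ∂ f (- + (w ℕ.∸ k))      ≡⟨ ∂-antisymmetric f-symmetric (+ (w ℕ.∸ k)) ⟩
    - ∂ f (+ (w ℕ.∸ k))      ≡⟨ cong -_ (sym (a≗∂f (w ℕ.∸ k))) ⟩
    - a (w ℕ.∸ k)            ∎

  ∂-qbinom-vanishesAbove : ∀ w h j → suc (w ℕ.* h) ℕ.< j → ∂ (qbinom w h) (+ j) ≡ 0ℤ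
  ∂-qbinom-vanishesAbove w h (suc j) wh+1<j+1 =
    cong₂ _-_ (qbinom-vanishesAbove w h j wh<j) (qbinom-vanishesAbove w h (suc j ℕ.+ 1) wh<j+2)
    where
    wh<j = ℕₚ.≤-pred wh+1<j+1
    wh<j+2 = ℕₚ.<-≤-trans wh<j (ℕₚ.≤-trans (ℕₚ.n≤1+n j) (ℕₚ.m≤m+n (suc j) 1))

  [1+w]h+1<k+2h⇒wh+1<k+h : ∀ w h k → suc w ℕ.* h ℕ.+ 1 ℕ.< k ℕ.+ 2 ℕ.* h → suc (w ℕ.* h) ℕ.< k ℕ.+ h
  [1+w]h+1<k+2h⇒wh+1<k+h w h k hyp =
    ℕₚ.+-cancelˡ-< h _ _ (subst₂ ℕ._<_ ([1+w]h+1≡h+[1+wh] w h) (k+2h≡h+[k+h] k h) hyp)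
    where
    [1+w]h+1≡h+[1+wh] : ∀ w h → (1 ℕ.+ w) ℕ.* h ℕ.+ 1 ≡ h ℕ.+ (1 ℕ.+ w ℕ.* h)
    [1+w]h+1≡h+[1+wh] = ℕ-Solver.solve-∀
    k+2h≡h+[k+h] : ∀ k h → k ℕ.+ 2 ℕ.* h ≡ h ℕ.+ (k ℕ.+ h)
    k+2h≡h+[k+h] = ℕ-Solver.solve-∀

  wh+1<k+h⇒w<k : ∀ w h k → 1 ℕ.≤ k → suc (w ℕ.* suc h) ℕ.< k ℕ.+ suc h → w ℕ.< k
  wh+1<k+h⇒w<k zero    h k 1≤k _   = 1≤k
  wh+1<k+h⇒w<k (suc w) h k _   hyp = ℕₚ.+-cancelʳ-< (suc h) (suc w) k (ℕₚ.≤-<-trans w+h≤wh hyp)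
    where
    [1+w]+[1+h]≡1+[[1+h]+w] : ∀ w h → suc w ℕ.+ suc h ≡ suc (suc h ℕ.+ w)
    [1+w]+[1+h]≡1+[[1+h]+w] = ℕ-Solver.solve-∀
    w+h≤wh : suc w ℕ.+ suc h ℕ.≤ suc (suc w ℕ.* suc h)
    w+h≤wh = ℕₚ.≤-trans (ℕₚ.≤-reflexive ([1+w]+[1+h]≡1+[[1+h]+w] w h))
                        (ℕ.s≤s (ℕₚ.+-monoʳ-≤ (suc h) (ℕₚ.m≤m*n w (suc h))))

  recurrence : ∀ w h k {a a₁ a₂ : ℕ → ℤ} →
    a ≗ ∂ (qbinom (suc w) (suc h)) ∘ +_ → a₁ ≗ ∂ (qbinom w (suc h)) ∘ +_ →
    a₂ ≗ ∂ (qbinom (suc w) h) ∘ +_ →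
    (1 ℕ.≤ k → suc w ℕ.* suc h ℕ.+ 1 ℕ.< k ℕ.+ 2 ℕ.* suc h → a k ≡ a₂ (k ℕ.∸ suc w))
    × (suc w ℕ.< k → a k ≡ a₂ (k ℕ.∸ suc w) + a₁ (k ℕ.+ suc h))
    × (k ℕ.≤ suc w → a k ≡ a₁ (k ℕ.+ suc h) - a₂ (suc w ℕ.∸ k))
  recurrence w h k {a} {a₁} {a₂} a≗ a₁≗ a₂≗ = top , middle , bottom
    where
    c₂ = qbinom (suc w) h
    pascal-split : a k ≡ ∂ c₂ (+ k - + suc w) + a₁ (k ℕ.+ suc h)
    pascal-split = begin
      a k                                                              ≡⟨ a≗ k ⟩
      ∂ (qbinom (suc w) (suc h)) (+ k)                                 ≡⟨ ∂-pascal c₂ (qbinom w (suc h)) _ _ (+ k) ⟩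
      ∂ c₂ (+ k - + suc w) + ∂ (qbinom w (suc h)) (+ (k ℕ.+ suc h))  ≡⟨ cong (_+_ (∂ c₂ (+ k - + suc w)))
                                                                            (sym (a₁≗ (k ℕ.+ suc h))) ⟩
      ∂ c₂ (+ k - + suc w) + a₁ (k ℕ.+ suc h)                          ∎
    top : 1 ℕ.≤ k → suc w ℕ.* suc h ℕ.+ 1 ℕ.< k ℕ.+ 2 ℕ.* suc h → a k ≡ a₂ (k ℕ.∸ suc w)
    top 1≤k hyp = begin
      a k                                      ≡⟨ pascal-split ⟩
      ∂ c₂ (+ k - + suc w) + a₁ (k ℕ.+ suc h)  ≡⟨ cong₂ _+_ (∂-sub-≥ c₂ a₂≗ w<k) a₁-vanishes ⟩
      a₂ (k ℕ.∸ suc w) + 0ℤ                    ≡⟨ +-identityʳ _ ⟩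
      a₂ (k ℕ.∸ suc w)                         ∎
      where
      beyond-degree = [1+w]h+1<k+2h⇒wh+1<k+h w (suc h) k hyp
      w<k = wh+1<k+h⇒w<k w h k 1≤k beyond-degree
      a₁-vanishes : a₁ (k ℕ.+ suc h) ≡ 0ℤ
      a₁-vanishes =
        trans (a₁≗ (k ℕ.+ suc h)) (∂-qbinom-vanishesAbove w (suc h) (k ℕ.+ suc h) beyond-degree)
    middle : suc w ℕ.< k → a k ≡ a₂ (k ℕ.∸ suc w) + a₁ (k ℕ.+ suc h)
    middle w<k = trans pascal-split (cong (_+ a₁ (k ℕ.+ suc h)) (∂-sub-≥ c₂ a₂≗ (ℕₚ.<⇒≤ w<k)))
    bottom : k ℕ.≤ suc w → a k ≡ a₁ (k ℕ.+ suc h) - a₂ (suc w ℕ.∸ k)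
    bottom k≤w = begin
      a k                                      ≡⟨ pascal-split ⟩
      ∂ c₂ (+ k - + suc w) + a₁ (k ℕ.+ suc h)  ≡⟨ cong (_+ a₁ (k ℕ.+ suc h))
                                                       (∂-sub-≤ c₂ a₂≗ (qbinom-symmetric (suc w) h) k≤w) ⟩
      - a₂ (suc w ℕ.∸ k) + a₁ (k ℕ.+ suc h)    ≡⟨ +-comm (- a₂ (suc w ℕ.∸ k)) _ ⟩
      a₁ (k ℕ.+ suc h) - a₂ (suc w ℕ.∸ k)      ∎

open import Data.Nat using (ℕ; _+_; _*_; _∸_; _≤_; _<_; _%_)
open import Data.Integer using (ℤ) renaming (_+_ to _+ℤ_; _-_ to _-ℤ_)
open import Data.Product using (_×_)
open import Relation.Binary.PropositionalEquality using (_≡_)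

open import Data.Nat using (zero; suc)
open import Data.Nat.Properties using (*-comm)
open import Data.Product using (_,_)
open import Relation.Binary.PropositionalEquality using (subst)
open QBinomialCoefficients using (recurrence; coeffSeq-∂; coeffSeq-∂ᵀ)

proposition3p2 : (w h k : ℕ) (a a₁ a₂ : ℕ → ℤ) →
    1 ≤ w → 1 ≤ h → 1 ≤ k → k ≤ h * w + 1 → k % 2 ≡ (w * h + 1) % 2 →
    IsCoeffSeq w h a → IsCoeffSeq (w ∸ 1) h a₁ → IsCoeffSeq w (h ∸ 1) a₂ →
    ((w * h + 1 < k + 2 * w → a k ≡ a₁ (k ∸ h))
     × (h < k → k + 2 * w ≤ h * w + 1 → a k ≡ a₁ (k ∸ h) +ℤ a₂ (k + w))
     × (k ≤ h → a k ≡ a₂ (k + w) -ℤ a₁ (h ∸ k)))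
    × ((w * h + 1 < k + 2 * h → a k ≡ a₂ (k ∸ w))
     × (w < k → k + 2 * h ≤ h * w + 1 → a k ≡ a₂ (k ∸ w) +ℤ a₁ (k + h))
     × (k ≤ w → a k ≡ a₁ (k + h) -ℤ a₂ (w ∸ k)))
-- The range and parity conditions on k and the upper bounds in the middle cases are not needed.
proposition3p2 zero    _       _ _ _ _  () _ _ _ _ _ _ _
proposition3p2 (suc w) zero    _ _ _ _  _ () _ _ _ _ _ _
proposition3p2 (suc w) (suc h) k a a₁ a₂ _ _ 1≤k _ _ isCoeffSeq isCoeffSeq₁ isCoeffSeq₂ =
  let (top , middle , bottom) = recurrence w h k (coeffSeq-∂ (suc w) (suc h) isCoeffSeq)
        (coeffSeq-∂ w (suc h) isCoeffSeq₁) (coeffSeq-∂ (suc w) h isCoeffSeq₂)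
      (topᵀ , middleᵀ , bottomᵀ) = recurrence h w k (coeffSeq-∂ᵀ (suc w) (suc h) isCoeffSeq)
        (coeffSeq-∂ᵀ (suc w) h isCoeffSeq₂) (coeffSeq-∂ᵀ w (suc h) isCoeffSeq₁)
  in ( (λ bound → topᵀ 1≤k (subst (λ m → m + 1 < k + 2 * suc w) (*-comm (suc w) (suc h)) bound))
     , (λ h<k _ → middleᵀ h<k)
     , bottomᵀ )
   , ( top 1≤k
     , (λ w<k _ → middle w<k)
     , bottom )
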